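{- For each $n\geq1$ and every $k$, the number of linear extensions $w$ of $\varepsilon Z_n$ with $\mathrm{des}(w)=k$ equals the number of $u\in U_n$ with $\mathrm{ret}_1(u)=k$; equivalently \[ Z_n(t)=\sum_{w\in\mathcal{L}(\varepsilon Z_n)}t^{1+\mathrm{des}(w)}=\sum_{u\in U_n}t^{1+\mathrm{ret}_1(u)}. \]
   Context: The zig-zag poset $Z_n$ on $[n]$ is generated by $j<j+1$ for odd $j\in[n-1]$ and $j>j+1$ for even $j$. $\varepsilon\in S_n$ is the involution swapping $2i$ and $2i+1$ for every $i\ge1$ with $2i+1\leq n$, and $\varepsilon Z_n$ is the poset with $\varepsilon(i)<\varepsilon(j)$ iff $i<_{Z_n}j$. $\mathcal{L}(P)$ is the set of $\pi\in S_n$ with $\pi^{ -1}(i)<\pi^{ -1}(j)$ whenever $i<_Pj$. $\mathrm{des}(w)=|\{i\in[n-1]:w(i)>w(i+1)\}|$. $U_n$ is the set of up-down alternating permutations $u\in S_n$ ($u(1)<u(2)>u(3)<\cdots$). For $u\in S_n$, $\mathrm{ret}_1(u)=|\{i\in[n-1]:u^{ -1}(i)>u^{ -1}(i+1)+1\}|$ (number of big returns). -}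

module Defs where

open import Data.Nat using (ℕ; zero; suc; _+_; _∸_; _≤_; _<_; _>_; _<?_; _≡ᵇ_)
open import Data.Nat using (_*_)
open import Data.Bool using (Bool; true; false; if_then_else_; not)
open import Data.List using (List; []; _∷_; map; upTo; length; filter)
open import Data.List.Relation.Binary.Permutation.Propositional using (_↭_)
open import Data.Product using (Σ; ∃; _×_)
open import Data.Unit using (⊤)
open import Relation.Binary.PropositionalEquality using (_≡_)
open import Relation.Binary.Construct.Closure.Transitive using (TransClosure)

-- Permutations of [n] = {1,…,n} in one-line notation: w = [w(1), …, w(n)].
oneTo : ℕ → List ℕ
oneTo n = map suc (upTo n)

IsPerm : ℕ → List ℕ → Set
IsPerm n w = w ↭ oneTo n

-- pos i w = w⁻¹(i) (1-based position of the value i in w; correct for permutations).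
pos : ℕ → List ℕ → ℕ
pos i [] = 0
pos i (x ∷ xs) = if i ≡ᵇ x then 1 else suc (pos i xs)

isEven : ℕ → Bool
isEven zero = true
isEven (suc m) = not (isEven m)

Even : ℕ → Set
Even j = ∃ λ m → j ≡ 2 * m

Odd : ℕ → Set
Odd j = ∃ λ m → j ≡ suc (2 * m)

data ZGen (n : ℕ) : ℕ → ℕ → Set where
  up   : ∀ {j} → Odd j  → 1 ≤ j → j < n → ZGen n j (suc j)
  down : ∀ {j} → Even j → 1 ≤ j → j < n → ZGen n (suc j) j

Z< : ℕ → ℕ → ℕ → Set
Z< n = TransClosure (ZGen n)

-- ε ∈ S_n: swaps 2i and 2i+1 for each i ≥ 1 with 2i+1 ≤ n; fixes everything else.
ε : ℕ → ℕ → ℕ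
ε n i with isEven i | 1 Data.Nat.<ᵇ i | i Data.Nat.<ᵇ n | i Data.Nat.≤ᵇ n
... | true  | true | true | _    = suc i      -- i = 2m ≥ 2 and i+1 ≤ n
... | false | true | _    | true = i ∸ 1      -- i = 2m+1 ≥ 3 and i ≤ n
... | _     | _    | _    | _    = i

εZ< : ℕ → ℕ → ℕ → Set
εZ< n x y = ∃ λ a → ∃ λ b → ε n a ≡ x × ε n b ≡ y × Z< n a b

IsLinExt : ℕ → (ℕ → ℕ → Set) → List ℕ → Set
IsLinExt n P w = IsPerm n w × (∀ i j → P i j → pos i w < pos j w)

des : List ℕ → ℕ
des [] = 0
des (x ∷ []) = 0
des (x ∷ y ∷ r) = (if y Data.Nat.<ᵇ x then 1 else 0) + des (y ∷ r)

-- u(1) < u(2) > u(3) < ⋯ ; the flag says whether the next step must go up.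
AltFrom : Bool → List ℕ → Set
AltFrom b [] = ⊤
AltFrom b (x ∷ []) = ⊤
AltFrom true  (x ∷ y ∷ r) = x < y × AltFrom false (y ∷ r)
AltFrom false (x ∷ y ∷ r) = x > y × AltFrom true (y ∷ r)

IsUpDown : ℕ → List ℕ → Set
IsUpDown n u = IsPerm n u × AltFrom true u

ret₁ : ℕ → List ℕ → ℕ
ret₁ n u = length (filter (λ i → suc (pos (suc i) u) <? pos i u) (oneTo (n ∸ 1)))

SameCard : (List ℕ → Set) → (List ℕ → Set) → Set
SameCard P Q =
  Σ (List ℕ → List ℕ) λ f → Σ (List ℕ → List ℕ) λ g →
    (∀ w → P w → Q (f w)) × (∀ u → Q u → P (g u)) ×
    (∀ w → P w → g (f w) ≡ w) × (∀ u → Q u → f (g u) ≡ u)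

-- Send a linear extension w of εZ_n to u = (ε ∘ w)⁻¹, i.e. u(p) = w⁻¹(ε p).  Since ε is an
-- involution, w is a linear extension exactly when p ↦ w⁻¹(ε p) increases along the covering
-- relations of Z_n, which says that u rises at odd and falls at even positions: u is up-down.
-- The descents of w = ε ∘ u⁻¹ are the i with ε a < ε b for a = u⁻¹(i+1), b = u⁻¹(i).  As ε
-- moves every point by at most one, this agrees with a + 1 < b (a big return) unless a and b are
-- adjacent, and the two adjacent cases are settled by the parity of the position of the
-- corresponding rise or fall of the alternating u.
module Submission where

open import Defs
open import Data.Bool using (Bool; true; false; not; if_then_else_)
open import Data.Bool.Properties using (not-involutive; T-≡)
open import Data.Empty using (⊥-elim)
open import Data.List using (List; []; _∷_; map; upTo; applyUpTo; length; filter)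
open import Data.List.Properties using (length-map; length-upTo; map-upTo; map-∘; map-cong; map-id; map-cong-local)
open import Data.List.Membership.Propositional using (_∈_)
open import Data.List.Membership.Propositional.Properties using (∈-map⁺; ∈-map⁻; ∈-upTo⁺; ∈-upTo⁻)
open import Data.List.Membership.Propositional.Properties.WithK using (unique∧set⇒bag)
open import Data.List.Relation.Unary.Any as Any using (here; there)
open import Data.List.Relation.Unary.All as All using (All)
open import Data.List.Relation.Unary.All.Properties using () renaming (map⁺ to All-map⁺)
open import Data.List.Relation.Unary.AllPairs using ([]; _∷_)
open import Data.List.Relation.Unary.Unique.Propositional using (Unique)
open import Data.List.Relation.Unary.Unique.Propositional.Properties using (upTo⁺) renaming (map⁺ to Unique-map⁺)
open import Data.List.Relation.Binary.BagAndSetEquality using (∼bag⇒↭)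
open import Data.List.Relation.Binary.Permutation.Propositional using (_↭_; ↭-sym; ↭⇒↭ₛ)
open import Data.List.Relation.Binary.Permutation.Propositional.Properties using (∈-resp-↭; ↭-length)
import Data.List.Relation.Binary.Permutation.Setoid.Properties as ↭ₛ
open import Data.Nat using (ℕ; zero; suc; _+_; _∸_; _*_; _≤_; _<_; _<?_; _≡ᵇ_; _<ᵇ_; _≤ᵇ_; z≤n; s≤s)
open import Data.Nat.Properties
open import Data.Product using (_×_; _,_; proj₁; proj₂)
open import Data.Sum using (_⊎_; inj₁; inj₂)
open import Function.Base using (id; _∘_)
open import Function.Bundles using (_⇔_; mk⇔; Equivalence)
open import Relation.Nullary using (yes; no; does)
open import Relation.Unary using (Decidable)
open import Relation.Binary.Definitions using (tri<; tri≈; tri>)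
open import Relation.Binary.PropositionalEquality
open import Relation.Binary.Construct.Closure.Transitive using (TransClosure; [_]; _∷_)

-- nth L p = L(p) for 1 ≤ p ≤ length L, and the junk value 0 otherwise.
nth : List ℕ → ℕ → ℕ
nth []       _             = 0
nth (x ∷ xs) zero          = 0
nth (x ∷ xs) (suc zero)    = x
nth (x ∷ xs) (suc (suc p)) = nth xs (suc p)

nth-∷ : ∀ x xs {p} → 1 ≤ p → nth (x ∷ xs) (suc p) ≡ nth xs p
nth-∷ x xs (s≤s z≤n) = refl

nth-∈ : ∀ L {p} → 1 ≤ p → p ≤ length L → nth L p ∈ L
nth-∈ (x ∷ L) {suc zero}    _ _         = here refl
nth-∈ (x ∷ L) {suc (suc p)} _ (s≤s p<) = there (nth-∈ L (s≤s z≤n) p<)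

nth-map : ∀ (h : ℕ → ℕ) L {p} → 1 ≤ p → p ≤ length L → nth (map h L) p ≡ h (nth L p)
nth-map h (x ∷ L) {suc zero}    _ _         = refl
nth-map h (x ∷ L) {suc (suc p)} _ (s≤s p<) = nth-map h L (s≤s z≤n) p<

nth-applyUpTo : ∀ (g : ℕ → ℕ) {m q} → q < m → nth (applyUpTo g m) (suc q) ≡ g q
nth-applyUpTo g {suc m} {zero}  _         = refl
nth-applyUpTo g {suc m} {suc q} (s≤s q<m) = nth-applyUpTo (g ∘ suc) q<m

applyUpTo-nth : ∀ L → applyUpTo (λ q → nth L (suc q)) (length L) ≡ L
applyUpTo-nth []      = refl
applyUpTo-nth (x ∷ L) = cong (x ∷_) (applyUpTo-nth L)

pos-here : ∀ x xs → pos x (x ∷ xs) ≡ 1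
pos-here x xs with x ≡ᵇ x | ≡⇒≡ᵇ x x refl
... | true | _ = refl

pos-there : ∀ {i x} xs → i ≢ x → pos i (x ∷ xs) ≡ suc (pos i xs)
pos-there {i} {x} xs i≢x with i ≡ᵇ x | ≡ᵇ⇒≡ i x
... | true  | i≡x = ⊥-elim (i≢x (i≡x _))
... | false | _   = refl

pos-bounds : ∀ {i} L → i ∈ L → 1 ≤ pos i L × pos i L ≤ length L
pos-bounds {i} (x ∷ L) i∈ with i ≟ x
... | yes refl rewrite pos-here i L = s≤s z≤n , s≤s z≤n
... | no i≢x rewrite pos-there L i≢x = s≤s z≤n , s≤s (proj₂ (pos-bounds L (Any.tail i≢x i∈)))

nth-pos : ∀ {i} L → i ∈ L → nth L (pos i L) ≡ i
nth-pos {i} (x ∷ L) i∈ with i ≟ x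
... | yes refl rewrite pos-here i L = refl
... | no i≢x rewrite pos-there L i≢x =
  let i∈L = Any.tail i≢x i∈ in trans (nth-∷ x L (proj₁ (pos-bounds L i∈L))) (nth-pos L i∈L)

pos-nth : ∀ L → Unique L → ∀ {p} → 1 ≤ p → p ≤ length L → pos (nth L p) L ≡ p
pos-nth (x ∷ L) _           {suc zero}    _ _         = pos-here x L
pos-nth (x ∷ L) (x∉L ∷ uL) {suc (suc p)} _ (s≤s p<) =
  let y∈L = nth-∈ L (s≤s z≤n) p< in
  trans (pos-there L (λ y≡x → All.lookup x∉L y∈L (sym y≡x))) (cong suc (pos-nth L uL (s≤s z≤n) p<))

pos-map : ∀ {h : ℕ → ℕ} → (∀ {a b} → h a ≡ h b → a ≡ b) → ∀ x L → pos (h x) (map h L) ≡ pos x L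
pos-map         h-inj x []      = refl
pos-map {h = h} h-inj x (y ∷ L) with x ≟ y
... | yes refl rewrite pos-here (h x) (map h L) | pos-here x L = refl
... | no x≢y rewrite pos-there (map h L) (x≢y ∘ h-inj) | pos-there L x≢y = cong suc (pos-map h-inj x L)

oneTo-suc : ∀ m → oneTo (suc m) ≡ 1 ∷ map suc (oneTo m)
oneTo-suc m = cong (λ xs → 1 ∷ map suc xs) (sym (map-upTo suc m))

∈-oneTo⁺ : ∀ {n z} → 1 ≤ z → z ≤ n → z ∈ oneTo n
∈-oneTo⁺ {z = suc i} _ i<n = ∈-map⁺ suc (∈-upTo⁺ i<n)

∈-oneTo⁻ : ∀ {n z} → z ∈ oneTo n → 1 ≤ z × z ≤ n
∈-oneTo⁻ z∈ with _ , i∈ , refl ← ∈-map⁻ suc z∈ = s≤s z≤n , ∈-upTo⁻ i∈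

length-oneTo : ∀ n → length (oneTo n) ≡ n
length-oneTo n = trans (length-map suc (upTo n)) (length-upTo n)

Unique-oneTo : ∀ n → Unique (oneTo n)
Unique-oneTo n = Unique-map⁺ suc-injective (upTo⁺ n)

nth-map-oneTo : ∀ (f : ℕ → ℕ) {n p} → p ∈ oneTo n → nth (map f (oneTo n)) p ≡ f p
nth-map-oneTo f {p = zero} p∈ with () ← proj₁ (∈-oneTo⁻ p∈)
nth-map-oneTo f {n} {suc q} p∈ = begin
  nth (map f (oneTo n)) (suc q)       ≡⟨ cong (λ xs → nth xs (suc q)) (sym (map-∘ (upTo n))) ⟩
  nth (map (f ∘ suc) (upTo n)) (suc q) ≡⟨ cong (λ xs → nth xs (suc q)) (map-upTo (f ∘ suc) n) ⟩
  nth (applyUpTo (f ∘ suc) n) (suc q)  ≡⟨ nth-applyUpTo (f ∘ suc) (proj₂ (∈-oneTo⁻ p∈)) ⟩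
  f (suc q)                            ∎
  where open ≡-Reasoning

map-nth-oneTo : ∀ L → map (nth L) (oneTo (length L)) ≡ L
map-nth-oneTo L = begin
  map (nth L) (oneTo (length L))             ≡⟨ sym (map-∘ (upTo (length L))) ⟩
  map (nth L ∘ suc) (upTo (length L))        ≡⟨ map-upTo (nth L ∘ suc) (length L) ⟩
  applyUpTo (nth L ∘ suc) (length L)         ≡⟨ applyUpTo-nth L ⟩
  L                                          ∎
  where open ≡-Reasoning

Unique-map-on : ∀ (f : ℕ → ℕ) {xs} → (∀ {x y} → x ∈ xs → y ∈ xs → f x ≡ f y → x ≡ y) →
                Unique xs → Unique (map f xs)
Unique-map-on f {[]}     _     []          = []
Unique-map-on f {x ∷ xs} f-inj (x∉xs ∷ u) =
  All-map⁺ (All.tabulate λ y∈ fx≡fy → All.lookup x∉xs y∈ (f-inj (here refl) (there y∈) fx≡fy))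
  ∷ Unique-map-on f (λ x∈ y∈ → f-inj (there x∈) (there y∈)) u

IsPerm-unique : ∀ {n u} → IsPerm n u → Unique u
IsPerm-unique {n} p = ↭ₛ.Unique-resp-↭ (setoid ℕ) (↭⇒↭ₛ (↭-sym p)) (Unique-oneTo n)

IsPerm-∈ : ∀ {n u z} → IsPerm n u → z ∈ u → z ∈ oneTo n
IsPerm-∈ p = ∈-resp-↭ p

IsPerm-∋ : ∀ {n u z} → IsPerm n u → z ∈ oneTo n → z ∈ u
IsPerm-∋ p = ∈-resp-↭ (↭-sym p)

IsPerm-length : ∀ {n u} → IsPerm n u → length u ≡ n
IsPerm-length {n} p = trans (↭-length p) (length-oneTo n)

Unique⇒IsPerm : ∀ {n u} → Unique u → (∀ {z} → z ∈ u → z ∈ oneTo n) → (∀ {z} → z ∈ oneTo n → z ∈ u) →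
                IsPerm n u
Unique⇒IsPerm {n} uu into onto = ∼bag⇒↭ (unique∧set⇒bag uu (Unique-oneTo n) (mk⇔ into onto))

IsPerm-pos : ∀ {n u i} → IsPerm n u → i ∈ oneTo n → pos i u ∈ oneTo n
IsPerm-pos pu i∈ with lo , hi ← pos-bounds _ (IsPerm-∋ pu i∈) = ∈-oneTo⁺ lo (subst (_ ≤_) (IsPerm-length pu) hi)

IsPerm-nth-pos : ∀ {n u i} → IsPerm n u → i ∈ oneTo n → nth u (pos i u) ≡ i
IsPerm-nth-pos pu i∈ = nth-pos _ (IsPerm-∋ pu i∈)

IsPerm-nth : ∀ {n u p} → IsPerm n u → p ∈ oneTo n → nth u p ∈ oneTo n
IsPerm-nth pu p∈ with lo , hi ← ∈-oneTo⁻ p∈ =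
  IsPerm-∈ pu (nth-∈ _ lo (subst (_ ≤_) (sym (IsPerm-length pu)) hi))

IsPerm-pos-nth : ∀ {n u p} → IsPerm n u → p ∈ oneTo n → pos (nth u p) u ≡ p
IsPerm-pos-nth pu p∈ with lo , hi ← ∈-oneTo⁻ p∈ =
  pos-nth _ (IsPerm-unique pu) lo (subst (_ ≤_) (sym (IsPerm-length pu)) hi)

IsPerm-map : ∀ {n w} {h : ℕ → ℕ} → (∀ i → h (h i) ≡ i) → (∀ {i} → i ∈ oneTo n → h i ∈ oneTo n) →
             IsPerm n w → IsPerm n (map h w)
IsPerm-map {n} {w} {h} h-inv h-range pw = Unique⇒IsPerm (Unique-map⁺ h-inj (IsPerm-unique pw)) into onto
  where
  h-inj : ∀ {a b} → h a ≡ h b → a ≡ b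
  h-inj {a} {b} ha≡hb = trans (sym (h-inv a)) (trans (cong h ha≡hb) (h-inv b))
  into : ∀ {z} → z ∈ map h w → z ∈ oneTo n
  into z∈ with _ , y∈ , refl ← ∈-map⁻ h z∈ = h-range (IsPerm-∈ pw y∈)
  onto : ∀ {z} → z ∈ oneTo n → z ∈ map h w
  onto {z} z∈ = subst (_∈ map h w) (h-inv z) (∈-map⁺ h (IsPerm-∋ pw (h-range z∈)))

inverse : ℕ → List ℕ → List ℕ
inverse n u = map (λ i → pos i u) (oneTo n)

length-inverse : ∀ n u → length (inverse n u) ≡ n
length-inverse n u = trans (length-map _ (oneTo n)) (length-oneTo n)

nth-inverse : ∀ {n p} u → p ∈ oneTo n → nth (inverse n u) p ≡ pos p u
nth-inverse u = nth-map-oneTo (λ i → pos i u)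

IsPerm-inverse : ∀ {n u} → IsPerm n u → IsPerm n (inverse n u)
IsPerm-inverse {n} {u} pu = Unique⇒IsPerm (Unique-map-on (λ i → pos i u) pos-inj (Unique-oneTo n)) into onto
  where
  pos-inj : ∀ {i j} → i ∈ oneTo n → j ∈ oneTo n → pos i u ≡ pos j u → i ≡ j
  pos-inj i∈ j∈ eq = trans (sym (IsPerm-nth-pos pu i∈)) (trans (cong (nth u) eq) (IsPerm-nth-pos pu j∈))
  into : ∀ {z} → z ∈ inverse n u → z ∈ oneTo n
  into z∈ with _ , i∈ , refl ← ∈-map⁻ _ z∈ = IsPerm-pos pu i∈
  onto : ∀ {p} → p ∈ oneTo n → p ∈ inverse n u
  onto p∈ = subst (_∈ inverse n u) (IsPerm-pos-nth pu p∈) (∈-map⁺ _ (IsPerm-nth pu p∈))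

pos-inverse : ∀ {n u p} → IsPerm n u → p ∈ oneTo n → pos p (inverse n u) ≡ nth u p
pos-inverse {n} {u} {p} pu p∈ = begin
  pos p (inverse n u)                              ≡⟨ cong (λ t → pos t (inverse n u)) (IsPerm-pos-nth pu p∈) ⟨
  pos (pos (nth u p) u) (inverse n u)              ≡⟨ cong (λ t → pos t (inverse n u)) (nth-inverse u q∈) ⟨
  pos (nth (inverse n u) (nth u p)) (inverse n u)  ≡⟨ IsPerm-pos-nth (IsPerm-inverse pu) q∈ ⟩
  nth u p                                          ∎
  where
  open ≡-Reasoning
  q∈ = IsPerm-nth pu p∈

inverse-involutive : ∀ {n u} → IsPerm n u → inverse n (inverse n u) ≡ u
inverse-involutive {n} {u} pu = begin
  map (λ p → pos p (inverse n u)) (oneTo n)  ≡⟨ map-cong-local (All.tabulate (pos-inverse pu)) ⟩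
  map (nth u) (oneTo n)                      ≡⟨ cong (λ m → map (nth u) (oneTo m)) (sym (IsPerm-length pu)) ⟩
  map (nth u) (oneTo (length u))             ≡⟨ map-nth-oneTo u ⟩
  u                                          ∎
  where open ≡-Reasoning

Even⇒Odd-suc : ∀ {j} → Even j → Odd (suc j)
Even⇒Odd-suc (m , j≡2m) = m , cong suc j≡2m

Odd⇒Even-suc : ∀ {j} → Odd j → Even (suc j)
Odd⇒Even-suc (m , j≡2m+1) = suc m , trans (cong suc j≡2m+1) (sym (*-suc 2 m))

Odd-suc⇒Even : ∀ {j} → Odd (suc j) → Even j
Odd-suc⇒Even (m , j+1≡2m+1) = m , suc-injective j+1≡2m+1

Even-suc⇒Odd : ∀ {j} → Even (suc j) → Odd j
Even-suc⇒Odd (suc m , j+1≡2m+2) = m , suc-injective (trans j+1≡2m+2 (*-suc 2 m))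

even-or-odd : ∀ j → Even j ⊎ Odd j
even-or-odd zero = inj₁ (0 , refl)
even-or-odd (suc j) with even-or-odd j
... | inj₁ e = inj₂ (Even⇒Odd-suc e)
... | inj₂ o = inj₁ (Odd⇒Even-suc o)

isEven-double : ∀ m → isEven (2 * m) ≡ true
isEven-double zero    = refl
isEven-double (suc m) = trans (cong isEven (*-suc 2 m)) (trans (not-involutive _) (isEven-double m))

Even⇒isEven : ∀ {j} → Even j → isEven j ≡ true
Even⇒isEven (m , refl) = isEven-double m

Odd⇒isEven : ∀ {j} → Odd j → isEven j ≡ false
Odd⇒isEven (m , refl) = cong not (Even⇒isEven (m , refl))

isEven⇒>1 : ∀ {j} → isEven j ≡ true → 1 ≤ j → 1 < j
isEven⇒>1 {suc (suc j)} _ _ = s≤s (s≤s z≤n)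

ε-up : ∀ {n i} → isEven i ≡ true → 1 < i → suc i ≤ n → ε n i ≡ suc i
ε-up {n} {i} even 1<i i<n
  rewrite even | Equivalence.to T-≡ (<⇒<ᵇ 1<i) | Equivalence.to T-≡ (<⇒<ᵇ i<n) = refl

ε-down : ∀ {n j} → isEven j ≡ true → 1 ≤ j → suc j ≤ n → ε n (suc j) ≡ j
ε-down {n} {j} even 1≤j j<n
  rewrite even | Equivalence.to T-≡ (<⇒<ᵇ (s≤s 1≤j)) | Equivalence.to T-≡ (≤⇒≤ᵇ j<n) = refl

data εView (n : ℕ) : ℕ → ℕ → Set where
  swap-up   : ∀ {i} → isEven i ≡ true → 1 < i → suc i ≤ n → εView n i (suc i)
  swap-down : ∀ {j} → isEven j ≡ true → 1 < j → suc j ≤ n → εView n (suc j) j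
  fixed     : ∀ {i} → εView n i i

εview : ∀ n i → εView n i (ε n i)
εview n i with isEven i in even | 1 <ᵇ i in 1<i | i <ᵇ n in i<n | i ≤ᵇ n in i≤n
... | true  | true  | true  | _     =
  swap-up even (<ᵇ⇒< 1 i (Equivalence.from T-≡ 1<i)) (<ᵇ⇒< i n (Equivalence.from T-≡ i<n))
... | false | true  | _     | true  =
  odd-view even (<ᵇ⇒< 1 i (Equivalence.from T-≡ 1<i)) (≤ᵇ⇒≤ i n (Equivalence.from T-≡ i≤n))
  where
  odd-view : ∀ {i} → isEven i ≡ false → 1 < i → i ≤ n → εView n i (i ∸ 1)
  odd-view {suc j} odd (s≤s 1≤j) j<n =
    let even-j = trans (sym (not-involutive _)) (cong not odd) in swap-down even-j (isEven⇒>1 even-j 1≤j) j<n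
... | true  | true  | false | _     = fixed
... | true  | false | _     | _     = fixed
... | false | false | _     | _     = fixed
... | false | true  | _     | false = fixed

ε-involutive : ∀ n i → ε n (ε n i) ≡ i
ε-involutive n i with ε n i in εi≡ | εview n i
... | _ | swap-up   even 1<i i<n = ε-down even (<⇒≤ 1<i) i<n
... | _ | swap-down even 1<j j<n = ε-up even 1<j j<n
... | _ | fixed                  = εi≡

ε-injective : ∀ n {a b} → ε n a ≡ ε n b → a ≡ b
ε-injective n {a} {b} εa≡εb = trans (sym (ε-involutive n a)) (trans (cong (ε n) εa≡εb) (ε-involutive n b))

ε-∈-oneTo : ∀ n {i} → i ∈ oneTo n → ε n i ∈ oneTo n
ε-∈-oneTo n {i} i∈ with ε n i | εview n i
... | _ | swap-up   _ _   i<n = ∈-oneTo⁺ (s≤s z≤n) i<n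
... | _ | swap-down _ 1<j j<n = ∈-oneTo⁺ (<⇒≤ 1<j) (<⇒≤ j<n)
... | _ | fixed               = i∈

ε≤suc : ∀ n i → ε n i ≤ suc i
ε≤suc n i with ε n i | εview n i
... | _ | swap-up   _ _ _ = ≤-refl
... | j | swap-down _ _ _ = ≤-trans (n≤1+n j) (n≤1+n (suc j))
... | _ | fixed           = n≤1+n i

≤suc-ε : ∀ n i → i ≤ suc (ε n i)
≤suc-ε n i with ε n i | εview n i
... | _ | swap-up   _ _ _ = ≤-trans (n≤1+n i) (n≤1+n (suc i))
... | _ | swap-down _ _ _ = ≤-refl
... | _ | fixed           = n≤1+n i

ε-even-≥ : ∀ n {i} → Even i → i ≤ ε n i
ε-even-≥ n {i} e with ε n i | εview n i
... | _ | swap-up   _ _ _    = n≤1+n i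
... | _ | swap-down even _ _ with () ← trans (sym (Even⇒isEven e)) (cong not even)
... | _ | fixed              = ≤-refl

ε-odd-≤ : ∀ n {i} → Odd i → ε n i ≤ i
ε-odd-≤ n {i} o with ε n i | εview n i
... | _ | swap-up   even _ _ with () ← trans (sym (Odd⇒isEven o)) even
... | j | swap-down _ _ _    = n≤1+n j
... | _ | fixed              = ≤-refl

ε-even-swap : ∀ n {a} → Even a → 1 ≤ a → suc a ≤ n → ε n a ≡ suc a
ε-even-swap n e 1≤a a<n = ε-up (Even⇒isEven e) (isEven⇒>1 (Even⇒isEven e) 1≤a) a<n

-- ε moves every point by at most one, so it preserves gaps of size at least two.
ε-mono-gap : ∀ n {a b} → suc a < b → ε n a < ε n b
ε-mono-gap n {a} {b} a+1<b =
  ≤∧≢⇒< (≤-trans (ε≤suc n a) (≤-pred (≤-trans a+1<b (≤suc-ε n b))))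
        (<⇒≢ (<-trans (n<1+n a) a+1<b) ∘ ε-injective n)

IsPerm-map-ε : ∀ {n w} → IsPerm n w → IsPerm n (map (ε n) w)
IsPerm-map-ε {n} = IsPerm-map (ε-involutive n) (ε-∈-oneTo n)

map-ε-involutive : ∀ n L → map (ε n) (map (ε n) L) ≡ L
map-ε-involutive n L = trans (sym (map-∘ L)) (trans (map-cong (ε-involutive n) L) (map-id L))

pos-map-ε : ∀ n p w → pos p (map (ε n) w) ≡ pos (ε n p) w
pos-map-ε n p w =
  trans (cong (λ t → pos t (map (ε n) w)) (sym (ε-involutive n p))) (pos-map (ε-injective n) (ε n p) w)

Step : Bool → ℕ → ℕ → Set
Step true  x y = x < y
Step false x y = y < x

Step-true : ∀ {b x y} → b ≡ true → Step b x y → x < y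
Step-true refl x<y = x<y

Step-false : ∀ {b x y} → b ≡ false → Step b x y → y < x
Step-false refl y<x = y<x

-- The direction of the step from position q + 1 to q + 2 of a list satisfying AltFrom b.
stepDir : Bool → ℕ → Bool
stepDir b zero    = b
stepDir b (suc q) = stepDir (not b) q

stepDir-not : ∀ b q → stepDir (not b) q ≡ not (stepDir b q)
stepDir-not b zero    = refl
stepDir-not b (suc q) = stepDir-not (not b) q

stepDir-true : ∀ q → stepDir true q ≡ isEven q
stepDir-true zero    = refl
stepDir-true (suc q) = trans (stepDir-not true q) (cong not (stepDir-true q))

AltFrom⇒Step : ∀ b L → AltFrom b L → ∀ q → suc (suc q) ≤ length L →
               Step (stepDir b q) (nth L (suc q)) (nth L (suc (suc q)))
AltFrom⇒Step _     (x ∷ [])    _           zero    (s≤s ())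
AltFrom⇒Step true  (x ∷ y ∷ r) (x<y , alt) zero    _        = x<y
AltFrom⇒Step false (x ∷ y ∷ r) (x>y , alt) zero    _        = x>y
AltFrom⇒Step true  (x ∷ y ∷ r) (_ , alt)   (suc q) (s≤s l) = AltFrom⇒Step false (y ∷ r) alt q l
AltFrom⇒Step false (x ∷ y ∷ r) (_ , alt)   (suc q) (s≤s l) = AltFrom⇒Step true (y ∷ r) alt q l

Step⇒AltFrom : ∀ b L →
               (∀ q → suc (suc q) ≤ length L → Step (stepDir b q) (nth L (suc q)) (nth L (suc (suc q)))) →
               AltFrom b L
Step⇒AltFrom b     []          _    = _
Step⇒AltFrom b     (x ∷ [])    _    = _
Step⇒AltFrom true  (x ∷ y ∷ r) step =
  step 0 (s≤s (s≤s z≤n)) , Step⇒AltFrom false (y ∷ r) (λ q → step (suc q) ∘ s≤s)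
Step⇒AltFrom false (x ∷ y ∷ r) step =
  step 0 (s≤s (s≤s z≤n)) , Step⇒AltFrom true (y ∷ r) (λ q → step (suc q) ∘ s≤s)

alternating⇒ZGen-mono : ∀ {u x y} → AltFrom true u → ZGen (length u) x y → nth u x < nth u y
alternating⇒ZGen-mono {u} alt (up {suc q} odd _ l) =
  Step-true (trans (stepDir-true q) (Even⇒isEven (Odd-suc⇒Even odd))) (AltFrom⇒Step true u alt q l)
alternating⇒ZGen-mono {u} alt (down {suc q} even _ l) =
  Step-false (trans (stepDir-true q) (Odd⇒isEven (Even-suc⇒Odd even))) (AltFrom⇒Step true u alt q l)

ZGen-mono⇒alternating : ∀ {u} → (∀ {x y} → ZGen (length u) x y → nth u x < nth u y) → AltFrom true u
ZGen-mono⇒alternating {u} mono = Step⇒AltFrom true u step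
  where
  step : ∀ q → suc (suc q) ≤ length u → Step (stepDir true q) (nth u (suc q)) (nth u (suc (suc q)))
  step q l rewrite stepDir-true q with even-or-odd q
  ... | inj₁ e rewrite Even⇒isEven e = mono (up (Even⇒Odd-suc e) (s≤s z≤n) l)
  ... | inj₂ o rewrite Odd⇒isEven o  = mono (down (Odd⇒Even-suc o) (s≤s z≤n) l)

alternating-descent⇒even : ∀ {u p} → AltFrom true u → 1 ≤ p → suc p ≤ length u →
                           nth u (suc p) < nth u p → Even p
alternating-descent⇒even alt 1≤p l fall with even-or-odd _
... | inj₁ e = e
... | inj₂ o = ⊥-elim (<-asym fall (alternating⇒ZGen-mono alt (up o 1≤p l)))

alternating-ascent⇒odd : ∀ {u p} → AltFrom true u → 1 ≤ p → suc p ≤ length u →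
                         nth u p < nth u (suc p) → Odd p
alternating-ascent⇒odd alt 1≤p l rise with even-or-odd _
... | inj₂ o = o
... | inj₁ e = ⊥-elim (<-asym rise (alternating⇒ZGen-mono alt (down e 1≤p l)))

ZGen-bounds : ∀ {n x y} → ZGen n x y → x ∈ oneTo n × y ∈ oneTo n
ZGen-bounds (up   _ 1≤j j<n) = ∈-oneTo⁺ 1≤j (<⇒≤ j<n) , ∈-oneTo⁺ (s≤s z≤n) j<n
ZGen-bounds (down _ 1≤j j<n) = ∈-oneTo⁺ (s≤s z≤n) j<n , ∈-oneTo⁺ 1≤j (<⇒≤ j<n)

TransClosure-mono : ∀ {R : ℕ → ℕ → Set} (f : ℕ → ℕ) → (∀ {x y} → R x y → f x < f y) →
                    ∀ {x y} → TransClosure R x y → f x < f y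
TransClosure-mono f mono [ xRy ]        = mono xRy
TransClosure-mono f mono (xRy ∷ yR⁺z) = <-trans (mono xRy) (TransClosure-mono f mono yR⁺z)

toUpDown : ℕ → List ℕ → List ℕ
toUpDown n w = inverse n (map (ε n) w)

toLinExt : ℕ → List ℕ → List ℕ
toLinExt n u = map (ε n) (inverse n u)

toLinExt∘toUpDown : ∀ {n w} → IsPerm n w → toLinExt n (toUpDown n w) ≡ w
toLinExt∘toUpDown {n} {w} pw =
  trans (cong (map (ε n)) (inverse-involutive (IsPerm-map-ε pw))) (map-ε-involutive n w)

toUpDown∘toLinExt : ∀ {n u} → IsPerm n u → toUpDown n (toLinExt n u) ≡ u
toUpDown∘toLinExt {n} {u} pu =
  trans (cong (inverse n) (map-ε-involutive n (inverse n u))) (inverse-involutive pu)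

nth-toUpDown : ∀ {n p} w → p ∈ oneTo n → nth (toUpDown n w) p ≡ pos (ε n p) w
nth-toUpDown {n} {p} w p∈ = trans (nth-inverse (map (ε n) w) p∈) (pos-map-ε n p w)

pos-toLinExt : ∀ {n u p} → IsPerm n u → p ∈ oneTo n → pos (ε n p) (toLinExt n u) ≡ nth u p
pos-toLinExt {n} {u} {p} pu p∈ = trans (pos-map (ε-injective n) p (inverse n u)) (pos-inverse pu p∈)

nth-toLinExt : ∀ {n p} u → p ∈ oneTo n → nth (toLinExt n u) p ≡ ε n (pos p u)
nth-toLinExt {n} {p} u p∈ with lo , hi ← ∈-oneTo⁻ p∈ =
  trans (nth-map (ε n) (inverse n u) lo (subst (p ≤_) (sym (length-inverse n u)) hi))
        (cong (ε n) (nth-inverse u p∈))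

toUpDown-upDown : ∀ {n w} → IsLinExt n (εZ< n) w → IsUpDown n (toUpDown n w)
toUpDown-upDown {n} {w} (pw , ordered) = pu , ZGen-mono⇒alternating mono
  where
  pu = IsPerm-inverse (IsPerm-map-ε pw)
  mono : ∀ {x y} → ZGen (length (toUpDown n w)) x y → nth (toUpDown n w) x < nth (toUpDown n w) y
  mono g with gₙ ← subst (λ m → ZGen m _ _) (IsPerm-length pu) g with x∈ , y∈ ← ZGen-bounds gₙ =
    subst₂ _<_ (sym (nth-toUpDown w x∈)) (sym (nth-toUpDown w y∈)) (ordered _ _ (_ , _ , refl , refl , [ gₙ ]))

toLinExt-linExt : ∀ {n u} → IsUpDown n u → IsLinExt n (εZ< n) (toLinExt n u)
toLinExt-linExt {n} {u} (pu , alt) = IsPerm-map-ε (IsPerm-inverse pu) , ordered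
  where
  mono : ∀ {x y} → ZGen n x y → pos (ε n x) (toLinExt n u) < pos (ε n y) (toLinExt n u)
  mono g with x∈ , y∈ ← ZGen-bounds g =
    subst₂ _<_ (sym (pos-toLinExt pu x∈)) (sym (pos-toLinExt pu y∈))
      (alternating⇒ZGen-mono alt (subst (λ m → ZGen m _ _) (sym (IsPerm-length pu)) g))
  ordered : ∀ i j → εZ< n i j → pos i (toLinExt n u) < pos j (toLinExt n u)
  ordered _ _ (a , b , refl , refl , a<b) = TransClosure-mono (λ x → pos (ε n x) (toLinExt n u)) mono a<b

-- If b = a + 1, then u falls at a, so a is even and ε swaps a and a + 1; if a = b + 1, then u
-- rises at b, so b is odd and ε b ≤ b < b + 1 ≤ ε a.
upDown-ε-<⇔ : ∀ {n u a b} → IsUpDown n u → a ∈ oneTo n → b ∈ oneTo n → nth u a ≡ suc (nth u b) →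
              ε n a < ε n b ⇔ suc a < b
upDown-ε-<⇔ {n} {u} {a} {b} (pu , alt) a∈ b∈ ua≡ub+1 = mk⇔ to (ε-mono-gap n)
  where
  ub<ua : nth u b < nth u a
  ub<ua = subst (nth u b <_) (sym ua≡ub+1) (n<1+n _)
  to : ε n a < ε n b → suc a < b
  to εa<εb with <-cmp a b
  ... | tri≈ _ refl _ = ⊥-elim (<-irrefl refl εa<εb)
  ... | tri< a<b _ _ with suc a ≟ b
  ...   | no a+1≢b = ≤∧≢⇒< a<b a+1≢b
  ...   | yes refl = ⊥-elim (<-asym εa<εb εb<εa)
    where
    open ≤-Reasoning
    1≤a = proj₁ (∈-oneTo⁻ a∈)
    a+1≤n = proj₂ (∈-oneTo⁻ b∈)
    even-a = alternating-descent⇒even alt 1≤a (subst (_ ≤_) (sym (IsPerm-length pu)) a+1≤n) ub<ua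
    εa≡a+1 = ε-even-swap n even-a 1≤a a+1≤n
    εb<εa : ε n (suc a) < ε n a
    εb<εa = begin-strict
      ε n (suc a)     ≡⟨ cong (ε n) εa≡a+1 ⟨
      ε n (ε n a)     ≡⟨ ε-involutive n a ⟩
      a               <⟨ n<1+n a ⟩
      suc a           ≡⟨ εa≡a+1 ⟨
      ε n a           ∎
  to εa<εb | tri> _ _ b<a with suc b ≟ a
  ...   | no b+1≢a = ⊥-elim (<-asym εa<εb (ε-mono-gap n (≤∧≢⇒< b<a b+1≢a)))
  ...   | yes refl = ⊥-elim (<-asym εa<εb (≤-<-trans (ε-odd-≤ n odd-b) (ε-even-≥ n (Odd⇒Even-suc odd-b))))
    where
    b+1≤len = subst (_ ≤_) (sym (IsPerm-length pu)) (proj₂ (∈-oneTo⁻ a∈))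
    odd-b = alternating-ascent⇒odd alt (proj₁ (∈-oneTo⁻ b∈)) b+1≤len ub<ua

length-filter-∷ : ∀ {P : ℕ → Set} (P? : Decidable P) x xs →
                  length (filter P? (x ∷ xs)) ≡ (if does (P? x) then 1 else 0) + length (filter P? xs)
length-filter-∷ P? x xs with does (P? x)
... | true  = refl
... | false = refl

length-filter-map : ∀ {P : ℕ → Set} (P? : Decidable P) (f : ℕ → ℕ) xs →
                    length (filter P? (map f xs)) ≡ length (filter (P? ∘ f) xs)
length-filter-map P? f []       = refl
length-filter-map P? f (x ∷ xs) with does (P? (f x))
... | true  = cong suc (length-filter-map P? f xs)
... | false = length-filter-map P? f xs

filter-cong-∈ : ∀ {P Q : ℕ → Set} (P? : Decidable P) (Q? : Decidable Q) {xs} →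
                (∀ {x} → x ∈ xs → P x ⇔ Q x) → filter P? xs ≡ filter Q? xs
filter-cong-∈ P? Q? {[]}     _   = refl
filter-cong-∈ P? Q? {x ∷ xs} P⇔Q with P? x | Q? x
... | yes _  | yes _  = cong (x ∷_) (filter-cong-∈ P? Q? (P⇔Q ∘ there))
... | no _   | no _   = filter-cong-∈ P? Q? (P⇔Q ∘ there)
... | yes px | no ¬qx = ⊥-elim (¬qx (Equivalence.to (P⇔Q (here refl)) px))
... | no ¬px | yes qx = ⊥-elim (¬px (Equivalence.from (P⇔Q (here refl)) qx))

descentAt? : ∀ L → Decidable (λ i → nth L (suc i) < nth L i)
descentAt? L i = nth L (suc i) <? nth L i

des≡count : ∀ L → des L ≡ length (filter (descentAt? L) (oneTo (length L ∸ 1)))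
des≡count []          = refl
des≡count (x ∷ [])    = refl
des≡count (x ∷ y ∷ r) = begin
  head + des (y ∷ r)
    ≡⟨ cong (head +_) (des≡count (y ∷ r)) ⟩
  head + length (filter (descentAt? (y ∷ r)) (oneTo m))
    ≡⟨ cong (λ xs → head + length xs) (filter-cong-∈ _ _ shift) ⟩
  head + length (filter (descentAt? L ∘ suc) (oneTo m))
    ≡⟨ cong (head +_) (length-filter-map (descentAt? L) suc (oneTo m)) ⟨
  head + length (filter (descentAt? L) (map suc (oneTo m)))
    ≡⟨ length-filter-∷ (descentAt? L) 1 _ ⟨
  length (filter (descentAt? L) (1 ∷ map suc (oneTo m)))
    ≡⟨ cong (length ∘ filter (descentAt? L)) (oneTo-suc m) ⟨
  length (filter (descentAt? L) (oneTo (suc m)))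
    ∎
  where
  open ≡-Reasoning
  L = x ∷ y ∷ r
  m = length r
  head = if y <ᵇ x then 1 else 0
  shift : ∀ {i} → i ∈ oneTo m → nth (y ∷ r) (suc i) < nth (y ∷ r) i ⇔ nth L (suc (suc i)) < nth L (suc i)
  shift i∈ with s≤s z≤n ← proj₁ (∈-oneTo⁻ i∈) = mk⇔ id id

∈-oneTo-pred : ∀ {n i} → i ∈ oneTo (n ∸ 1) → i ∈ oneTo n × suc i ∈ oneTo n
∈-oneTo-pred {suc n} i∈ with lo , hi ← ∈-oneTo⁻ i∈ = ∈-oneTo⁺ lo (m≤n⇒m≤1+n hi) , ∈-oneTo⁺ (s≤s z≤n) (s≤s hi)

des-toLinExt : ∀ {n u} → IsUpDown n u → des (toLinExt n u) ≡ ret₁ n u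
des-toLinExt {n} {u} ud@(pu , _) = begin
  des w                                                  ≡⟨ des≡count w ⟩
  length (filter (descentAt? w) (oneTo (length w ∸ 1)))  ≡⟨ cong (λ m → count-descents (oneTo (m ∸ 1))) len ⟩
  length (filter (descentAt? w) (oneTo (n ∸ 1)))         ≡⟨ cong length (filter-cong-∈ _ _ descent⇔return) ⟩
  ret₁ n u                                               ∎
  where
  open ≡-Reasoning
  w = toLinExt n u
  count-descents = length ∘ filter (descentAt? w)
  len : length w ≡ n
  len = trans (length-map (ε n) (inverse n u)) (length-inverse n u)
  descent⇔return : ∀ {i} → i ∈ oneTo (n ∸ 1) → nth w (suc i) < nth w i ⇔ suc (pos (suc i) u) < pos i u
  descent⇔return {i} i∈ with i∈n , i+1∈n ← ∈-oneTo-pred i∈ =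
    subst₂ (λ x y → x < y ⇔ suc (pos (suc i) u) < pos i u)
           (sym (nth-toLinExt u i+1∈n)) (sym (nth-toLinExt u i∈n))
      (upDown-ε-<⇔ ud (IsPerm-pos pu i+1∈n) (IsPerm-pos pu i∈n)
        (trans (IsPerm-nth-pos pu i+1∈n) (cong suc (sym (IsPerm-nth-pos pu i∈n)))))

theorem3p2 : (n : ℕ) → 1 ≤ n → (k : ℕ) →
    SameCard (λ w → IsLinExt n (εZ< n) w × des w ≡ k)
             (λ u → IsUpDown n u × ret₁ n u ≡ k)
theorem3p2 n _ k = toUpDown n , toLinExt n , forth , back
                 , (λ w ((pw , _) , _) → toLinExt∘toUpDown pw)
                 , (λ u ((pu , _) , _) → toUpDown∘toLinExt pu)
  where
  forth : ∀ w → IsLinExt n (εZ< n) w × des w ≡ k → IsUpDown n (toUpDown n w) × ret₁ n (toUpDown n w) ≡ k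
  forth w (lin@(pw , _) , des≡k) =
    let ud = toUpDown-upDown lin in
    ud , trans (sym (des-toLinExt ud)) (trans (cong des (toLinExt∘toUpDown pw)) des≡k)
  back : ∀ u → IsUpDown n u × ret₁ n u ≡ k → IsLinExt n (εZ< n) (toLinExt n u) × des (toLinExt n u) ≡ k
  back u (ud , ret≡k) = toLinExt-linExt ud , trans (des-toLinExt ud) ret≡k
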